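{- (i) Let $n\geq 3$ and $k\in\{1,\ldots,n-2\}$, and let $G$ be obtained from $K_{n-1}$ by adding a new vertex $v$ joined by edges to exactly $k$ vertices of $K_{n-1}$. Then $mvd(G)=n-k+1$. (ii) If $n\geq 3$ and $G$ is obtained from $K_n$ by removing one edge, then $mvd(G)=3$; if $n\geq 4$ and $G$ is obtained from $K_n$ by removing two edges, then $mvd(G)\leq 4$.
   Context: For a vertex-colored graph and two nonadjacent vertices $x,y$, an $x$-$y$ vertex cut is a set $S\subseteq V(G)\setminus\{x,y\}$ such that $x$ and $y$ lie in different components of $G-S$; it is monochromatic if all its vertices have the same color. A vertex-coloring is an MVD-coloring if every pair of nonadjacent vertices has a monochromatic vertex cut separating them. $mvd(G)$ is the maximum number of colors used by an MVD-coloring of $G$. -}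

module Defs where

open import Data.Nat using (ℕ; zero; suc; _≤_)
open import Data.Fin using (Fin; zero; suc)
open import Data.Fin.Subset using (Subset; _∈_; _∉_)
open import Data.Product using (Σ; ∃; _×_; _,_)
open import Data.Sum using (_⊎_)
open import Data.List using (List)
open import Data.List.Relation.Unary.Any using (Any)
open import Function.Definitions using (Surjective)
open import Relation.Binary.PropositionalEquality using (_≡_; _≢_)
open import Relation.Nullary using (¬_)
open import Data.Empty using (⊥)

AdjRel : ℕ → Set₁
AdjRel n = Fin n → Fin n → Set

-- Reach E S x y : there is a path from x to y in G - S (all vertices of the
-- path, including x and y, lie outside S).
data Reach {n : ℕ} (E : AdjRel n) (S : Subset n) : Fin n → Fin n → Set where
  here : ∀ {x} → x ∉ S → Reach E S x x
  step : ∀ {x y z} → x ∉ S → E x y → Reach E S y z → Reach E S x z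

IsVertexCut : {n : ℕ} → AdjRel n → Subset n → Fin n → Fin n → Set
IsVertexCut E S x y = x ∉ S × y ∉ S × ¬ Reach E S x y

Monochromatic : {n m : ℕ} → (Fin n → Fin m) → Subset n → Set
Monochromatic {m = m} c S = Σ (Fin m) λ col → ∀ v → v ∈ S → c v ≡ col

UsesColours : {n m : ℕ} → (Fin n → Fin m) → Set
UsesColours c = Surjective _≡_ _≡_ c

IsMVDColouring : {n m : ℕ} → AdjRel n → (Fin n → Fin m) → Set
IsMVDColouring {n} E c =
  ∀ (x y : Fin n) → x ≢ y → ¬ E x y →
    Σ (Subset n) λ S → IsVertexCut E S x y × Monochromatic c S

HasMVDColouring : {n : ℕ} → AdjRel n → ℕ → Set
HasMVDColouring {n} E m =
  Σ (Fin n → Fin m) λ c → UsesColours c × IsMVDColouring E c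

MvdAtMost : {n : ℕ} → AdjRel n → ℕ → Set
MvdAtMost E m = ∀ m' → HasMVDColouring E m' → m' ≤ m

MvdIs : {n : ℕ} → AdjRel n → ℕ → Set
MvdIs E m = HasMVDColouring E m × MvdAtMost E m

-- The graph of part (i): vertex zero is the new vertex v, vertices suc i
-- (i : Fin m) form K_m = K_{n-1}; v is adjacent to suc i iff i ∈ N.
KPlusVertex : {m : ℕ} → Subset m → AdjRel (suc m)
KPlusVertex N zero    zero    = ⊥
KPlusVertex N zero    (suc j) = j ∈ N
KPlusVertex N (suc i) zero    = i ∈ N
KPlusVertex N (suc i) (suc j) = i ≢ j

-- K_n with the edges in the list E removed (edges given as ordered pairs,
-- removal is symmetric).
KnMinus : {n : ℕ} → List (Fin n × Fin n) → AdjRel n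
KnMinus R x y = x ≢ y × ¬ Any (λ e → ((x , y) ≡ e) ⊎ ((y , x) ≡ e)) R

-- Fix a nonadjacent pair x, y. Its monochromatic cut contains every common neighbour of x and
-- y, so all common neighbours share one colour and every other colour occurs on a vertex that
-- is not a common neighbour. For K_{n-1} plus v, taking x = v and y a non-neighbour of v, these
-- are v and its n-1-k non-neighbours; for K_n minus ab (and cd), taking x = a and y = b, they
-- are a, b and the other endpoints of missing edges at a or b.
-- Conversely, one colour on the neighbourhood of v (of a, for K_n - ab) and distinct colours
-- on all other vertices is an MVD-colouring, since the neighbourhood of v separates v from each
-- of its non-neighbours, and these are the only nonadjacent pairs.

module Submission where

open import Defs
open import Data.Nat using (ℕ; zero; suc; _≤_; _<_; _∸_; _+_; s≤s)
open import Data.Nat.Properties using (+-comm; +-∸-assoc; m<n⇒0<n∸m; <⇒≤; ≤-trans; n≤1+n)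
open import Data.Fin using (Fin; zero; suc; _≟_; punchIn; punchOut)
open import Data.Fin.Properties using (injective⇒≤; punchIn-injective; punchInᵢ≢i; punchIn-punchOut)
open import Data.Fin.Subset using (Subset; ∣_∣; inside; outside; _∈_; _∉_; ∁; ⁅_⁆; _∪_; Nonempty)
open import Data.Fin.Subset.Properties
  using (_∈?_; x∈p⇒x∉∁p; x∈∁p⇒x∉p; x∉p⇒x∈∁p; ∣∁p∣≡n∸∣p∣; p⊆p∪q; q⊆p∪q; x∈p∪q⁻; x∈⁅x⁆; x∈⁅y⁆⇒x≡y)
open import Data.Vec using ([]; _∷_; here; there)
open import Data.Product using (_×_; _,_; ∃; proj₁; proj₂)
open import Data.Product.Properties using (≡-dec)
open import Data.Sum using (_⊎_; inj₁; inj₂; [_,_])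
import Data.Sum as Sum
open import Data.List using (List; []; _∷_; length; map; lookup)
open import Data.List.Properties using (length-map)
open import Data.List.Membership.Propositional using () renaming (_∈_ to _∈ₗ_)
open import Data.List.Membership.Propositional.Properties using (∈-map⁺)
open import Data.List.Relation.Unary.Any using (Any; here; there; index; any?)
import Data.List.Relation.Unary.Any as Any
open import Data.List.Relation.Unary.Any.Properties using (lookup-index)
open import Function using (_∘_)
open import Function.Definitions using (Surjective)
open import Relation.Binary.PropositionalEquality
  using (_≡_; _≢_; refl; sym; trans; cong; subst; module ≡-Reasoning)
open import Relation.Nullary using (¬_; yes; no; contradiction)
open import Relation.Nullary.Decidable using (_⊎-dec_; decidable-stable)

enumeration⇒≤length : ∀ {m} {L : List (Fin m)} → (∀ j → j ∈ₗ L) → m ≤ length L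
enumeration⇒≤length {L = L} ∈L = injective⇒≤ index-injective
  where
  index-injective : ∀ {i j} → index (∈L i) ≡ index (∈L j) → i ≡ j
  index-injective {i} {j} eq =
    trans (lookup-index (∈L i)) (trans (cong (lookup L) eq) (sym (lookup-index (∈L j))))

surjective⇒≤length : ∀ {n m} {c : Fin n → Fin m} → Surjective _≡_ _≡_ c →
                     (L : List (Fin m)) → (∀ v → c v ∈ₗ L) → m ≤ length L
surjective⇒≤length surj L c∈L = enumeration⇒≤length λ j →
  subst (_∈ₗ L) (proj₂ (surj j) refl) (c∈L (proj₁ (surj j)))

elements : ∀ {n} → Subset n → List (Fin n)
elements []            = []
elements (inside  ∷ p) = zero ∷ map suc (elements p)
elements (outside ∷ p) = map suc (elements p)

length-elements : ∀ {n} (p : Subset n) → length (elements p) ≡ ∣ p ∣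
length-elements []            = refl
length-elements (inside  ∷ p) = cong suc (trans (length-map suc (elements p)) (length-elements p))
length-elements (outside ∷ p) = trans (length-map suc (elements p)) (length-elements p)

∈⇒∈elements : ∀ {n} {p : Subset n} {x} → x ∈ p → x ∈ₗ elements p
∈⇒∈elements {p = inside  ∷ p} here        = here refl
∈⇒∈elements {p = inside  ∷ p} (there x∈p) = there (∈-map⁺ suc (∈⇒∈elements x∈p))
∈⇒∈elements {p = outside ∷ p} (there x∈p) = ∈-map⁺ suc (∈⇒∈elements x∈p)

∣p∣>0⇒nonempty : ∀ {n} (p : Subset n) → 0 < ∣ p ∣ → Nonempty p
∣p∣>0⇒nonempty (inside  ∷ p) _ = zero , here
∣p∣>0⇒nonempty (outside ∷ p) 0<∣p∣ with ∣p∣>0⇒nonempty p 0<∣p∣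
... | x , x∈p = suc x , there x∈p

-- Numbers the elements of p by 1, …, ∣ p ∣ and sends everything outside p to 0.
rank : ∀ {n} (p : Subset n) → Fin n → Fin (suc ∣ p ∣)
rank (inside  ∷ p) zero    = suc zero
rank (inside  ∷ p) (suc x) = punchIn (suc zero) (rank p x)
rank (outside ∷ p) zero    = zero
rank (outside ∷ p) (suc x) = rank p x

rank-∉ : ∀ {n} {p : Subset n} {x} → x ∉ p → rank p x ≡ zero
rank-∉ {p = inside  ∷ p} {zero}  x∉p = contradiction here x∉p
rank-∉ {p = inside  ∷ p} {suc x} x∉p = cong (punchIn (suc zero)) (rank-∉ (x∉p ∘ there))
rank-∉ {p = outside ∷ p} {zero}  x∉p = refl
rank-∉ {p = outside ∷ p} {suc x} x∉p = rank-∉ (x∉p ∘ there)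

rank-surjective : ∀ {n} (p : Subset n) (r : Fin ∣ p ∣) → ∃ λ x → rank p x ≡ suc r
rank-surjective (inside  ∷ p) zero    = zero , refl
rank-surjective (inside  ∷ p) (suc r) with rank-surjective p r
... | x , eq = suc x , cong (punchIn (suc zero)) eq
rank-surjective (outside ∷ p) r with rank-surjective p r
... | x , eq = suc x , eq

Reach-source∉ : ∀ {n} {E : AdjRel n} {S x y} → Reach E S x y → x ∉ S
Reach-source∉ (here x∉S)     = x∉S
Reach-source∉ (step x∉S _ _) = x∉S

neighbours⊆⇒IsVertexCut : ∀ {n} {E : AdjRel n} {S x y} → x ∉ S → y ∉ S → x ≢ y →
                          (∀ w → E x w → w ∈ S) → IsVertexCut E S x y
neighbours⊆⇒IsVertexCut {E = E} {S} {x} x∉S y∉S x≢y N⊆S = x∉S , y∉S , x≢y ∘ reach⇒≡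
  where
  reach⇒≡ : ∀ {y} → Reach E S x y → x ≡ y
  reach⇒≡ (here _)                = refl
  reach⇒≡ (step {y = w} _ xw w⇝y) = contradiction (N⊆S w xw) (Reach-source∉ w⇝y)

neighbours⊆⇒IsVertexCut′ : ∀ {n} {E : AdjRel n} {S x y} → x ∉ S → y ∉ S → x ≢ y →
                           (∀ w → E w y → w ∈ S) → IsVertexCut E S x y
neighbours⊆⇒IsVertexCut′ {E = E} {S} {y = y} x∉S y∉S x≢y N⊆S = x∉S , y∉S , x≢y ∘ reach⇒≡
  where
  reach⇒≡ : ∀ {x} → Reach E S x y → x ≡ y
  reach⇒≡ (here _)             = refl
  reach⇒≡ (step x∉S xw w⇝y) with reach⇒≡ w⇝y
  ... | refl = contradiction (N⊆S _ xw) x∉S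

MvdAtMost-mono : ∀ {n} {E : AdjRel n} {m m′} → m ≤ m′ → MvdAtMost E m → MvdAtMost E m′
MvdAtMost-mono m≤m′ mvd≤m k colouring = ≤-trans (mvd≤m k colouring) m≤m′

CommonNeighbour : ∀ {n} → AdjRel n → Fin n → Fin n → Fin n → Set
CommonNeighbour E x y v = E x v × E v y

commonNeighbour∈cut : ∀ {n} {E : AdjRel n} {S x y v} → IsVertexCut E S x y →
                      CommonNeighbour E x y v → v ∈ S
commonNeighbour∈cut {S = S} {v = v} (x∉S , y∉S , ¬x⇝y) (xv , vy) with v ∈? S
... | yes v∈S = v∈S
... | no  v∉S = contradiction (step x∉S xv (step v∉S vy (here y∉S))) ¬x⇝y

mvd≤1+nonCommon : ∀ {n} {E : AdjRel n} {x y} → x ≢ y → ¬ E x y → (L : List (Fin n)) →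
                  (∀ v → v ∈ₗ L ⊎ CommonNeighbour E x y v) → MvdAtMost E (suc (length L))
mvd≤1+nonCommon {E = E} {x} {y} x≢y ¬xy L cover m (c , surj , mvd)
  with mvd x y x≢y ¬xy
... | S , cut , col , mono =
  subst (m ≤_) (cong suc (length-map c L)) (surjective⇒≤length surj (col ∷ map c L) c∈)
  where
  c∈ : ∀ v → c v ∈ₗ col ∷ map c L
  c∈ v with cover v
  ... | inj₁ v∈L    = there (∈-map⁺ c v∈L)
  ... | inj₂ common = here (mono v (commonNeighbour∈cut cut common))

module KPlusVertexMvd {m : ℕ} (N : Subset m) where

  G : AdjRel (suc m)
  G = KPlusVertex N

  colour : Fin (suc m) → Fin (suc (suc ∣ ∁ N ∣))
  colour zero    = zero
  colour (suc i) = suc (rank (∁ N) i)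

  neighbourhood : Subset (suc m)
  neighbourhood = outside ∷ N

  neighbourhood-monochromatic : Monochromatic colour neighbourhood
  neighbourhood-monochromatic =
    suc zero , λ { (suc i) (there i∈N) → cong suc (rank-∉ (x∈p⇒x∉∁p i∈N)) }

  neighbour⇒∈neighbourhood : ∀ w → G zero w → w ∈ neighbourhood
  neighbour⇒∈neighbourhood zero    ()
  neighbour⇒∈neighbourhood (suc i) i∈N = there i∈N

  nonNeighbour∉neighbourhood : ∀ {j} → ¬ G zero (suc j) → suc j ∉ neighbourhood
  nonNeighbour∉neighbourhood j∉N (there j∈N) = j∉N j∈N

  colour-mvd : IsMVDColouring G colour
  colour-mvd zero zero 0≢0 _ = contradiction refl 0≢0
  colour-mvd zero (suc j) 0≢j ¬0j =
    neighbourhood ,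
    neighbours⊆⇒IsVertexCut (λ ()) (nonNeighbour∉neighbourhood ¬0j) 0≢j neighbour⇒∈neighbourhood ,
    neighbourhood-monochromatic
  colour-mvd (suc i) zero i≢0 ¬i0 =
    neighbourhood ,
    neighbours⊆⇒IsVertexCut′ (nonNeighbour∉neighbourhood ¬i0) (λ ()) i≢0
      (λ { zero () ; (suc w) w∈N → there w∈N }) ,
    neighbourhood-monochromatic
  colour-mvd (suc i) (suc j) i≢j ¬ij = contradiction (i≢j ∘ cong suc) ¬ij

  colour-surjective : Nonempty N → UsesColours colour
  colour-surjective _          zero          = zero , λ { refl → refl }
  colour-surjective (i , i∈N) (suc zero)    = suc i , λ { refl → cong suc (rank-∉ (x∈p⇒x∉∁p i∈N)) }
  colour-surjective _          (suc (suc r)) with rank-surjective (∁ N) r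
  ... | i , eq = suc i , λ { refl → cong suc eq }

  mvd≤ : Nonempty (∁ N) → MvdAtMost G (suc (suc ∣ ∁ N ∣))
  mvd≤ (j , j∈∁N) =
    subst (MvdAtMost G ∘ suc) length-nonCommon
      (mvd≤1+nonCommon {x = zero} {y = suc j} (λ ()) (x∈∁p⇒x∉p j∈∁N) nonCommon cover)
    where
    nonCommon : List (Fin (suc m))
    nonCommon = zero ∷ map suc (elements (∁ N))

    length-nonCommon : length nonCommon ≡ suc ∣ ∁ N ∣
    length-nonCommon = cong suc (trans (length-map suc (elements (∁ N))) (length-elements (∁ N)))

    cover : ∀ v → v ∈ₗ nonCommon ⊎ CommonNeighbour G zero (suc j) v
    cover zero = inj₁ (here refl)
    cover (suc i) with i ∈? N
    ... | yes i∈N = inj₂ (i∈N , λ { refl → x∈∁p⇒x∉p j∈∁N i∈N })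
    ... | no  i∉N = inj₁ (there (∈-map⁺ suc (∈⇒∈elements (x∉p⇒x∈∁p i∉N))))

  mvd : Nonempty N → Nonempty (∁ N) → MvdIs G (suc (suc ∣ ∁ N ∣))
  mvd N≠∅ ∁N≠∅ = (colour , colour-surjective N≠∅ , colour-mvd) , mvd≤ ∁N≠∅

kPlusVertex-mvd : ∀ {m} (N : Subset m) → 0 < ∣ N ∣ → ∣ N ∣ < m →
                  MvdIs (KPlusVertex N) (suc m ∸ ∣ N ∣ + 1)
kPlusVertex-mvd {m} N 0<∣N∣ ∣N∣<m = subst (MvdIs (KPlusVertex N)) colours
  (KPlusVertexMvd.mvd N (∣p∣>0⇒nonempty N 0<∣N∣) (∣p∣>0⇒nonempty (∁ N) 0<∣∁N∣))
  where
  0<∣∁N∣ : 0 < ∣ ∁ N ∣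
  0<∣∁N∣ = subst (0 <_) (sym (∣∁p∣≡n∸∣p∣ N)) (m<n⇒0<n∸m ∣N∣<m)

  colours : suc (suc ∣ ∁ N ∣) ≡ suc m ∸ ∣ N ∣ + 1
  colours = begin
    suc (suc ∣ ∁ N ∣)     ≡⟨ cong (2 +_) (∣∁p∣≡n∸∣p∣ N) ⟩
    suc (suc (m ∸ ∣ N ∣)) ≡⟨ +-comm 1 (suc (m ∸ ∣ N ∣)) ⟩
    suc (m ∸ ∣ N ∣) + 1   ≡⟨ cong (_+ 1) (sym (+-∸-assoc 1 (<⇒≤ ∣N∣<m))) ⟩
    suc m ∸ ∣ N ∣ + 1     ∎
    where open ≡-Reasoning

Joins : ∀ {n} → Fin n → Fin n → Fin n × Fin n → Set
Joins x y e = (x , y) ≡ e ⊎ (y , x) ≡ e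

¬Joinsˡ : ∀ {n} {x y p q : Fin n} → x ≢ p → x ≢ q → ¬ Joins x y (p , q)
¬Joinsˡ x≢p x≢q (inj₁ xy≡pq) = x≢p (cong proj₁ xy≡pq)
¬Joinsˡ x≢p x≢q (inj₂ yx≡pq) = x≢q (cong proj₂ yx≡pq)

¬Joinsʳ : ∀ {n} {x y p q : Fin n} → y ≢ p → y ≢ q → ¬ Joins x y (p , q)
¬Joinsʳ y≢p y≢q (inj₁ xy≡pq) = y≢q (cong proj₂ xy≡pq)
¬Joinsʳ y≢p y≢q (inj₂ yx≡pq) = y≢p (cong proj₁ yx≡pq)

KnMinus-[] : ∀ {n} {x y : Fin n} → x ≢ y → KnMinus [] x y
KnMinus-[] x≢y = x≢y , λ ()

KnMinus-∷ : ∀ {n} {R : List (Fin n × Fin n)} {e x y} →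
            ¬ Joins x y e → KnMinus R x y → KnMinus (e ∷ R) x y
KnMinus-∷ ¬joins (x≢y , ¬removed) = x≢y , λ { (here joins) → ¬joins joins ; (there r) → ¬removed r }

KnMinus-sym : ∀ {n} {R : List (Fin n × Fin n)} {x y} → KnMinus R x y → KnMinus R y x
KnMinus-sym (x≢y , ¬removed) = x≢y ∘ sym , ¬removed ∘ Any.map Sum.swap

removed⇒¬KnMinus : ∀ {n} {R : List (Fin n × Fin n)} {x y} → Any (Joins x y) R → ¬ KnMinus R x y
removed⇒¬KnMinus removed (_ , ¬removed) = ¬removed removed

¬KnMinus⇒removed : ∀ {n} (R : List (Fin n × Fin n)) {x y} → x ≢ y → ¬ KnMinus R x y →
                   Any (Joins x y) R
¬KnMinus⇒removed R {x} {y} x≢y ¬xy = decidable-stable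
  (any? (λ e → ≡-dec _≟_ _≟_ (x , y) e ⊎-dec ≡-dec _≟_ _≟_ (y , x) e) R)
  (λ ¬removed → ¬xy (x≢y , ¬removed))

commonNeighbour-firstRemoved : ∀ {n} {R : List (Fin n × Fin n)} {a b v} → v ≢ a → v ≢ b →
                               KnMinus R a v → KnMinus R v b →
                               CommonNeighbour (KnMinus ((a , b) ∷ R)) a b v
commonNeighbour-firstRemoved v≢a v≢b av vb =
  KnMinus-∷ (¬Joinsʳ v≢a v≢b) av , KnMinus-∷ (¬Joinsˡ v≢a v≢b) vb

∃≢₂ : ∀ {n} (a b : Fin (suc (suc (suc n)))) → a ≢ b → ∃ λ t → t ≢ a × t ≢ b
∃≢₂ {n} a b a≢b = t , punchInᵢ≢i a j , t≢b
  where
  j : Fin (suc (suc n))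
  j = punchIn (punchOut a≢b) zero

  t : Fin (suc (suc (suc n)))
  t = punchIn a j

  t≢b : t ≢ b
  t≢b t≡b = punchInᵢ≢i (punchOut a≢b) zero
    (punchIn-injective a j (punchOut a≢b) (trans t≡b (sym (punchIn-punchOut a≢b))))

module KnMinusOneMvd {n : ℕ} {a b : Fin n} (a≢b : a ≢ b) where

  G : AdjRel n
  G = KnMinus ((a , b) ∷ [])

  ¬ab : ¬ G a b
  ¬ab = removed⇒¬KnMinus (here (inj₁ refl))

  commonNeighbour : ∀ {v} → v ≢ a → v ≢ b → CommonNeighbour G a b v
  commonNeighbour v≢a v≢b =
    commonNeighbour-firstRemoved v≢a v≢b (KnMinus-[] (v≢a ∘ sym)) (KnMinus-[] v≢b)

  mvd≤3 : MvdAtMost G 3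
  mvd≤3 = mvd≤1+nonCommon a≢b ¬ab (a ∷ b ∷ []) cover
    where
    cover : ∀ v → v ∈ₗ a ∷ b ∷ [] ⊎ CommonNeighbour G a b v
    cover v with v ≟ a | v ≟ b
    ... | yes v≡a | _        = inj₁ (here v≡a)
    ... | no _    | yes v≡b  = inj₁ (there (here v≡b))
    ... | no v≢a  | no v≢b   = inj₂ (commonNeighbour v≢a v≢b)

  colour : Fin n → Fin 3
  colour v with v ≟ a | v ≟ b
  ... | yes _ | _     = zero
  ... | no _  | yes _ = suc zero
  ... | no _  | no _  = suc (suc zero)

  colour-a : colour a ≡ zero
  colour-a with a ≟ a
  ... | yes _   = refl
  ... | no  a≢a = contradiction refl a≢a

  colour-b : colour b ≡ suc zero
  colour-b with b ≟ a | b ≟ b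
  ... | yes b≡a | _       = contradiction (sym b≡a) a≢b
  ... | no _    | yes _   = refl
  ... | no _    | no b≢b  = contradiction refl b≢b

  colour-other : ∀ {v} → v ≢ a → v ≢ b → colour v ≡ suc (suc zero)
  colour-other {v} v≢a v≢b with v ≟ a | v ≟ b
  ... | yes v≡a | _       = contradiction v≡a v≢a
  ... | no _    | yes v≡b = contradiction v≡b v≢b
  ... | no _    | no _    = refl

  colour-surjective : ∀ {t} → t ≢ a → t ≢ b → UsesColours colour
  colour-surjective     t≢a t≢b zero             = a , λ { refl → colour-a }
  colour-surjective     t≢a t≢b (suc zero)       = b , λ { refl → colour-b }
  colour-surjective {t} t≢a t≢b (suc (suc zero)) = t , λ { refl → colour-other t≢a t≢b }

  cut : Subset n
  cut = ∁ (⁅ a ⁆ ∪ ⁅ b ⁆)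

  ∈cut⁺ : ∀ {v} → v ≢ a → v ≢ b → v ∈ cut
  ∈cut⁺ v≢a v≢b = x∉p⇒x∈∁p λ v∈ab →
    [ v≢a ∘ x∈⁅y⁆⇒x≡y a , v≢b ∘ x∈⁅y⁆⇒x≡y b ] (x∈p∪q⁻ ⁅ a ⁆ ⁅ b ⁆ v∈ab)

  ∈cut⁻ : ∀ {v} → v ∈ cut → v ≢ a × v ≢ b
  ∈cut⁻ v∈cut = (λ { refl → x∈∁p⇒x∉p v∈cut (p⊆p∪q ⁅ b ⁆ (x∈⁅x⁆ a)) })
              , (λ { refl → x∈∁p⇒x∉p v∈cut (q⊆p∪q ⁅ a ⁆ ⁅ b ⁆ (x∈⁅x⁆ b)) })

  cut-monochromatic : Monochromatic colour cut
  cut-monochromatic =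
    suc (suc zero) , λ v v∈cut → colour-other (proj₁ (∈cut⁻ v∈cut)) (proj₂ (∈cut⁻ v∈cut))

  neighbour-a⇒∈cut : ∀ w → G a w → w ∈ cut
  neighbour-a⇒∈cut w aw@(a≢w , _) = ∈cut⁺ (a≢w ∘ sym) λ { refl → ¬ab aw }

  a∉cut : a ∉ cut
  a∉cut a∈cut = proj₁ (∈cut⁻ a∈cut) refl

  b∉cut : b ∉ cut
  b∉cut b∈cut = proj₂ (∈cut⁻ b∈cut) refl

  colour-mvd : IsMVDColouring G colour
  colour-mvd x y x≢y ¬xy with ¬KnMinus⇒removed _ x≢y ¬xy
  ... | here (inj₁ refl) =
    cut , neighbours⊆⇒IsVertexCut a∉cut b∉cut x≢y neighbour-a⇒∈cut , cut-monochromatic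
  ... | here (inj₂ refl) =
    cut , neighbours⊆⇒IsVertexCut′ b∉cut a∉cut x≢y (λ w → neighbour-a⇒∈cut w ∘ KnMinus-sym) ,
    cut-monochromatic

  mvd : ∀ {t} → t ≢ a → t ≢ b → MvdIs G 3
  mvd t≢a t≢b = (colour , colour-surjective t≢a t≢b , colour-mvd) , mvd≤3

module KnMinusTwoMvd {n : ℕ} {a b c d : Fin n} (a≢b : a ≢ b) where

  G : AdjRel n
  G = KnMinus ((a , b) ∷ (c , d) ∷ [])

  ¬ab : ¬ G a b
  ¬ab = removed⇒¬KnMinus (here (inj₁ refl))

  commonNeighbour : ∀ {v} → v ≢ a → v ≢ b → ¬ Joins a v (c , d) → ¬ Joins v b (c , d) →
                    CommonNeighbour G a b v
  commonNeighbour v≢a v≢b ¬av ¬vb = commonNeighbour-firstRemoved v≢a v≢b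
    (KnMinus-∷ ¬av (KnMinus-[] (v≢a ∘ sym))) (KnMinus-∷ ¬vb (KnMinus-[] v≢b))

  mvd≤4-meeting : ∀ e → (∀ {v} → v ≢ a → v ≢ b → v ≢ e → v ≢ c × v ≢ d) → MvdAtMost G 4
  mvd≤4-meeting e avoids = mvd≤1+nonCommon a≢b ¬ab (a ∷ b ∷ e ∷ []) cover
    where
    cover : ∀ v → v ∈ₗ a ∷ b ∷ e ∷ [] ⊎ CommonNeighbour G a b v
    cover v with v ≟ a | v ≟ b | v ≟ e
    ... | yes v≡a | _       | _       = inj₁ (here v≡a)
    ... | no _    | yes v≡b | _       = inj₁ (there (here v≡b))
    ... | no _    | no _    | yes v≡e = inj₁ (there (there (here v≡e)))
    ... | no v≢a  | no v≢b  | no v≢e  with avoids v≢a v≢b v≢e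
    ...   | v≢c , v≢d = inj₂ (commonNeighbour v≢a v≢b (¬Joinsʳ v≢c v≢d) (¬Joinsˡ v≢c v≢d))

  mvd≤3-disjoint : a ≢ c → a ≢ d → b ≢ c → b ≢ d → MvdAtMost G 3
  mvd≤3-disjoint a≢c a≢d b≢c b≢d = mvd≤1+nonCommon a≢b ¬ab (a ∷ b ∷ []) cover
    where
    cover : ∀ v → v ∈ₗ a ∷ b ∷ [] ⊎ CommonNeighbour G a b v
    cover v with v ≟ a | v ≟ b
    ... | yes v≡a | _       = inj₁ (here v≡a)
    ... | no _    | yes v≡b = inj₁ (there (here v≡b))
    ... | no v≢a  | no v≢b  = inj₂ (commonNeighbour v≢a v≢b (¬Joinsˡ a≢c a≢d) (¬Joinsʳ b≢c b≢d))

  mvd≤4 : MvdAtMost G 4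
  mvd≤4 with c ≟ a | c ≟ b | d ≟ a | d ≟ b
  ... | yes refl | _        | _        | _        = mvd≤4-meeting d λ v≢a _ v≢d → v≢a , v≢d
  ... | no _     | yes refl | _        | _        = mvd≤4-meeting d λ _ v≢b v≢d → v≢b , v≢d
  ... | no _     | no _     | yes refl | _        = mvd≤4-meeting c λ v≢a _ v≢c → v≢c , v≢a
  ... | no _     | no _     | no _     | yes refl = mvd≤4-meeting c λ _ v≢b v≢c → v≢c , v≢b
  ... | no c≢a   | no c≢b   | no d≢a   | no d≢b   =
    MvdAtMost-mono (n≤1+n 3) (mvd≤3-disjoint (c≢a ∘ sym) (d≢a ∘ sym) (c≢b ∘ sym) (d≢b ∘ sym))

lemma4p1 :
    (∀ (m k : ℕ) → 3 ≤ suc m → 1 ≤ k → k ≤ suc m ∸ 2 →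
      (N : Subset m) → ∣ N ∣ ≡ k →
      MvdIs (KPlusVertex N) (suc m ∸ k + 1))
    ×
    (∀ (n : ℕ) → 3 ≤ n → (a b : Fin n) → a ≢ b →
      MvdIs (KnMinus ((a , b) ∷ [])) 3)
    ×
    (∀ (n : ℕ) → 4 ≤ n → (a b c d : Fin n) → a ≢ b → c ≢ d →
      ¬ ((a , b) ≡ (c , d)) → ¬ ((a , b) ≡ (d , c)) →
      MvdAtMost (KnMinus ((a , b) ∷ (c , d) ∷ [])) 4)
lemma4p1 = kPlusVertex , knMinusOne , knMinusTwo
  where
  kPlusVertex : ∀ (m k : ℕ) → 3 ≤ suc m → 1 ≤ k → k ≤ suc m ∸ 2 →
                (N : Subset m) → ∣ N ∣ ≡ k → MvdIs (KPlusVertex N) (suc m ∸ k + 1)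
  kPlusVertex zero    k (s≤s ())
  kPlusVertex (suc m) k _ 1≤k k≤m N refl = kPlusVertex-mvd N 1≤k (s≤s k≤m)

  knMinusOne : ∀ (n : ℕ) → 3 ≤ n → (a b : Fin n) → a ≢ b → MvdIs (KnMinus ((a , b) ∷ [])) 3
  knMinusOne zero                ()
  knMinusOne (suc zero)          (s≤s ())
  knMinusOne (suc (suc zero))    (s≤s (s≤s ()))
  knMinusOne (suc (suc (suc n))) _ a b a≢b with ∃≢₂ a b a≢b
  ... | t , t≢a , t≢b = KnMinusOneMvd.mvd a≢b t≢a t≢b

  knMinusTwo : ∀ (n : ℕ) → 4 ≤ n → (a b c d : Fin n) → a ≢ b → c ≢ d →
               ¬ ((a , b) ≡ (c , d)) → ¬ ((a , b) ≡ (d , c)) →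
               MvdAtMost (KnMinus ((a , b) ∷ (c , d) ∷ [])) 4
  knMinusTwo _ _ a b c d a≢b _ _ _ = KnMinusTwoMvd.mvd≤4 a≢b
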